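{- Let $n\ge 1$, $i\in\{1,\dots,n-1\}$, and let $C$ be a set of transpositions in $S_n$ with $s_i\in C$. Put $D=C\cap s_iCs_i$. Then the divided difference operator $\partial_i$ is defined on all of $H_C$, and $\partial_i(H_C)\subseteq H_D$.
   Context: Permutations compose as functions: $(vw)(j)=v(w(j))$. $s_i=(i\leftrightarrow i+1)$. Let $H=\operatorname{Fun}(S_n,\mathbb{C}[t_1,\dots,t_n])$ with pointwise operations; write $f(v)=f(v;t_1,\dots,t_n)$. The star action is the right action $(f*w)(v)=f(vw^{ -1})$, extended linearly to the group algebra. In $H$, $t_j$ denotes the constant function $v\mapsto t_j$ and $x_j$ the function $v\mapsto t_{v(j)}$. For a transposition $\tau=(j\leftrightarrow k)$, $f\in H$ satisfies condition $\tau$ if $f-f*\tau=(x_j-x_k)g$ for some $g\in H$; these $f$ form a subring $H_\tau$, and for a set $C$ of transpositions $H_C=\bigcap_{\tau\in C}H_\tau$. For $f\in H_{s_i}$, $\partial_i(f)$ is the unique $g\in H$ with $f-f*s_i=(x_i-x_{i+1})g$. -}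

module Defs where

open import Level using (Level; _⊔_)
open import Algebra.Bundles using (CommutativeRing)
open import Data.Nat using (ℕ; zero; suc)
import Data.Nat as ℕ
open import Data.Nat.Properties using () renaming (_≟_ to _≟ℕ_)
open import Data.Fin using (Fin; inject₁)
open import Data.Fin.Permutation using (Permutation′; _⟨$⟩ʳ_; _∘ₚ_; flip; transpose)
import Data.Fin.Permutation as Perm
open import Data.Vec using (Vec; replicate; zipWith; updateAt)
open import Data.Vec.Properties using (≡-dec)
open import Data.List using (List; []; _∷_; _++_; map; concatMap)
open import Data.Product using (_×_; _,_; ∃)
open import Relation.Nullary using (yes; no; ¬_)
open import Relation.Binary.PropositionalEquality using (_≡_)

-- A set C of transpositions is a predicate on ordered pairs (j , k),
-- symmetric and irreflexive; the transposition (j ↔ k) lies in C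
-- iff C j k.
record TranspositionSet (n : ℕ) (p : Level) : Set (Level.suc p) where
  field
    mem   : Fin n → Fin n → Set p
    sym   : ∀ {j k} → mem j k → mem k j
    irrefl : ∀ {j k} → mem j k → ¬ (j ≡ k)
open TranspositionSet public


module _ {c ℓ : Level} (R : CommutativeRing c ℓ) where
  open CommutativeRing R renaming (Carrier to K)

  -- The polynomial ring K[t_1,…,t_n]: finite formal sums of terms
  -- (coefficient, exponent vector), compared coefficientwise.
  Monomial : ℕ → Set
  Monomial n = Vec ℕ n

  Poly : ℕ → Set c
  Poly n = List (K × Monomial n)

  coeff : ∀ {n} → Poly n → Monomial n → K
  coeff []             e = 0#
  coeff ((a , m) ∷ p)  e with ≡-dec _≟ℕ_ m e
  ... | yes _ = a + coeff p e
  ... | no  _ = coeff p e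

  _≈P_ : ∀ {n} → Poly n → Poly n → Set ℓ
  p ≈P q = ∀ e → coeff p e ≈ coeff q e

  _+P_ : ∀ {n} → Poly n → Poly n → Poly n
  p +P q = p ++ q

  -P_ : ∀ {n} → Poly n → Poly n
  -P p = map (λ { (a , m) → (- a , m) }) p

  _-P_ : ∀ {n} → Poly n → Poly n → Poly n
  p -P q = p +P (-P q)

  _*P_ : ∀ {n} → Poly n → Poly n → Poly n
  p *P q = concatMap (λ { (a , m) → map (λ { (b , m′) → (a * b , zipWith ℕ._+_ m m′) }) q }) p

  var : ∀ {n} → Fin n → Poly n
  var j = (1# , updateAt (replicate _ 0) j (λ _ → 1)) ∷ []

  -- Elements of S_n are
  -- stdlib permutations; a function on S_n must respect equality of
  -- permutations (Perm._≈_ : pointwise equality of the underlying maps).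
  record H (n : ℕ) : Set (c ⊔ ℓ) where
    field
      app  : Permutation′ n → Poly n
      resp : ∀ {v w} → v Perm.≈ w → app v ≈P app w
  open H public

  -- composition (v w)(j) = v (w j);  note  π₁ ∘ₚ π₂  applies π₁ first.
  _·_ : ∀ {n} → Permutation′ n → Permutation′ n → Permutation′ n
  v · w = w ∘ₚ v

  star : ∀ {n} → H n → Permutation′ n → Permutation′ n → Poly n
  star f w v = app f (v · flip w)

  x : ∀ {n} → Fin n → Permutation′ n → Poly n
  x j v = var (v ⟨$⟩ʳ j)

  DivRel : ∀ {n} → Fin n → Fin n → H n → H n → Set ℓ
  DivRel j k f g = ∀ v → (app f v -P star f (transpose j k) v) ≈P ((x j v -P x k v) *P app g v)

  Cond : ∀ {n} → Fin n → Fin n → H n → Set (c ⊔ ℓ)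
  Cond {n} j k f = ∃ λ (g : H n) → DivRel j k f g

  HC : ∀ {n p} → TranspositionSet n p → H n → Set (c ⊔ ℓ ⊔ p)
  HC C f = ∀ j k → mem C j k → Cond j k f

  HPred : ∀ {n p} → (Fin n → Fin n → Set p) → H n → Set (c ⊔ ℓ ⊔ p)
  HPred D f = ∀ j k → D j k → Cond j k f

-- s_i for i ∈ {1,…,n-1}, with n = suc m and i : Fin m (0-based)
s : ∀ {m} → Fin m → Permutation′ (suc m)
s i = transpose (inject₁ i) (Data.Fin.suc i)

-- D = C ∩ s_i C s_i :  (j ↔ k) ∈ s_i C s_i  iff  s_i (j ↔ k) s_i = (s_i j ↔ s_i k) ∈ C
Dset : ∀ {m p} → Fin m → (Fin (suc m) → Fin (suc m) → Set p) → Fin (suc m) → Fin (suc m) → Set p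
Dset i C j k = C j k × C (s i ⟨$⟩ʳ j) (s i ⟨$⟩ʳ k)

{-# OPTIONS --safe #-}
-- The divided difference g = ∂_i f exists because f satisfies condition s_i, and it is unique because
-- x_i − x_{i+1} is a non-zero-divisor in K[t]. Let τ = (j ↔ k) ∈ D. If τ = s_i, then g * s_i = g.
-- Otherwise, conditions τ and s_i τ s_i on f show that (x_i − x_{i+1})(g − g * τ) is divisible by
-- x_j − x_k. At each v the substitution t_{v j} := t_{v k} kills x_j − x_k and keeps x_i − x_{i+1} a
-- non-zero-divisor, so it kills g − g * τ; by division with remainder, g − g * τ is then divisible by
-- x_j − x_k, which is condition τ for g.
module Submission where

open import Defs hiding (sym)
open import Level using (_⊔_)
open import Algebra.Bundles using (CommutativeRing)
open import Data.Empty using (⊥-elim)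
open import Data.Nat using (ℕ; zero; suc; pred) renaming (_+_ to _+ℕ_)
import Data.Nat.Properties as ℕ
open import Data.Fin using (Fin; inject₁)
open import Data.Fin.Properties using () renaming (_≟_ to _≟F_)
import Data.Fin.Permutation.Components as PC
open import Data.Fin.Permutation using (Permutation′; _⟨$⟩ʳ_; transpose; flip)
import Data.Fin.Permutation as Perm
open import Data.List using ([]; _∷_; _++_; map)
open import Data.Product using (_×_; _,_; ∃; proj₁; proj₂)
open import Data.Vec using (Vec; _∷_; lookup; updateAt; replicate; zipWith)
open import Data.Vec.Properties
  using ( ≡-dec; lookup∘updateAt; lookup∘updateAt′; updateAt-updateAt; updateAt-id-local; updateAt-commutes
        ; zipWith-identityˡ)
open import Function using (_∘_)
open import Function.Bundles using (Injection)
open import Function.Definitions using (Injective)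
open import Function.Properties.Inverse using (Inverse⇒Injection)
open import Relation.Binary.PropositionalEquality as ≡ using (_≡_; _≢_; cong)
open import Relation.Nullary using (¬_; Dec; yes; no)
open import Relation.Nullary.Decidable using (dec-true; dec-false; _×-dec_)

private
  variable
    n : ℕ
    a b y : Fin n

raise lower : Fin n → Vec ℕ n → Vec ℕ n
raise a e = updateAt e a suc
lower a e = updateAt e a pred

lookup-raise : ∀ (a : Fin n) e → lookup (raise a e) a ≡ suc (lookup e a)
lookup-raise a e = lookup∘updateAt a e

lookup-lower : ∀ (a : Fin n) e → lookup (lower a e) a ≡ pred (lookup e a)
lookup-lower a e = lookup∘updateAt a e

lookup-raise-≢ : a ≢ b → ∀ e → lookup (raise b e) a ≡ lookup e a
lookup-raise-≢ {a = a} {b} a≢b e = lookup∘updateAt′ a b a≢b e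

lookup-lower-≢ : a ≢ b → ∀ e → lookup (lower b e) a ≡ lookup e a
lookup-lower-≢ {a = a} {b} a≢b e = lookup∘updateAt′ a b a≢b e

lower-raise : ∀ (a : Fin n) e → lower a (raise a e) ≡ e
lower-raise a e = ≡.trans (updateAt-updateAt a e) (updateAt-id-local a e ≡.refl)

raise-lower : ∀ (a : Fin n) e {k} → lookup e a ≡ suc k → raise a (lower a e) ≡ e
raise-lower a e eq =
  ≡.trans (updateAt-updateAt a e) (updateAt-id-local a e (≡.trans (cong (suc ∘ pred) eq) (≡.sym eq)))

zipWith-+-unit : ∀ (a : Fin n) e → zipWith _+ℕ_ (updateAt (replicate _ 0) a (λ _ → 1)) e ≡ raise a e
zipWith-+-unit Fin.zero    (k ∷ e) = cong (suc k ∷_) (zipWith-identityˡ ℕ.+-identityˡ e)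
zipWith-+-unit (Fin.suc a) (k ∷ e) = cong (k ∷_) (zipWith-+-unit a e)

lookup-suc-zero⇒≢ : ∀ (a : Fin n) {u v : Vec ℕ n} {k} → lookup u a ≡ suc k → lookup v a ≡ zero → u ≢ v
lookup-suc-zero⇒≢ a u≡suc v≡0 ≡.refl = ℕ.1+n≢0 (≡.trans (≡.sym u≡suc) v≡0)

permutation-injective : ∀ (π : Permutation′ n) → Injective _≡_ _≡_ (π ⟨$⟩ʳ_)
permutation-injective π = Injection.injective (Inverse⇒Injection π)

transpose-matchˡ : ∀ (a b : Fin n) → PC.transpose a b a ≡ b
transpose-matchˡ a b rewrite dec-true (a ≟F a) ≡.refl = ≡.refl

transpose-matchʳ : ∀ (a b : Fin n) → PC.transpose a b b ≡ a
transpose-matchʳ a b with b ≟F a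
... | yes b≡a = b≡a
... | no  _   rewrite dec-true (b ≟F b) ≡.refl = ≡.refl

transpose-other : y ≢ a → y ≢ b → PC.transpose a b y ≡ y
transpose-other {y = y} {a} {b} y≢a y≢b rewrite dec-false (y ≟F a) y≢a | dec-false (y ≟F b) y≢b = ≡.refl

transpose-comm : ∀ (a b y : Fin n) → PC.transpose a b y ≡ PC.transpose b a y
transpose-comm a b y = cases (y ≟F a) (y ≟F b)
  where
  cases : Dec (y ≡ a) → Dec (y ≡ b) → PC.transpose a b y ≡ PC.transpose b a y
  cases (yes ≡.refl) _          = ≡.trans (transpose-matchˡ y b) (≡.sym (transpose-matchʳ b y))
  cases (no _)     (yes ≡.refl) = ≡.trans (transpose-matchʳ a y) (≡.sym (transpose-matchˡ y a))
  cases (no y≢a)   (no y≢b)   = ≡.trans (transpose-other y≢a y≢b) (≡.sym (transpose-other y≢b y≢a))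

transpose-involutive : ∀ (a b y : Fin n) → PC.transpose a b (PC.transpose a b y) ≡ y
transpose-involutive a b y = ≡.trans (cong (PC.transpose a b) (transpose-comm a b y)) (PC.transpose-inverse a b)

transpose-conj : ∀ (π : Fin n → Fin n) → Injective _≡_ _≡_ π → ∀ a b y →
                 PC.transpose (π a) (π b) (π y) ≡ π (PC.transpose a b y)
transpose-conj π inj a b y = cases (y ≟F a) (y ≟F b)
  where
  cases : Dec (y ≡ a) → Dec (y ≡ b) → PC.transpose (π a) (π b) (π y) ≡ π (PC.transpose a b y)
  cases (yes ≡.refl) _          = ≡.trans (transpose-matchˡ (π y) (π b)) (cong π (≡.sym (transpose-matchˡ y b)))
  cases (no _)     (yes ≡.refl) = ≡.trans (transpose-matchʳ (π a) (π y)) (cong π (≡.sym (transpose-matchʳ a y)))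
  cases (no y≢a)   (no y≢b)   =
    ≡.trans (transpose-other (y≢a ∘ inj) (y≢b ∘ inj)) (cong π (≡.sym (transpose-other y≢a y≢b)))

transpose-conj-transpose : ∀ (a b j k y : Fin n) →
  PC.transpose b a (PC.transpose (PC.transpose a b k) (PC.transpose a b j) y) ≡ PC.transpose k j (PC.transpose b a y)
transpose-conj-transpose a b j k y = begin
  σ⁻¹ (PC.transpose (σ k) (σ j) y)
    ≡⟨ cong (σ⁻¹ ∘ PC.transpose (σ k) (σ j)) (PC.transpose-inverse a b {y}) ⟨
  σ⁻¹ (PC.transpose (σ k) (σ j) (σ (σ⁻¹ y)))
    ≡⟨ cong σ⁻¹ (transpose-conj σ (permutation-injective (transpose a b)) k j (σ⁻¹ y)) ⟩
  σ⁻¹ (σ (PC.transpose k j (σ⁻¹ y)))         ≡⟨ PC.transpose-inverse b a ⟩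
  PC.transpose k j (σ⁻¹ y)                   ∎
  where
  open ≡.≡-Reasoning
  σ = PC.transpose a b
  σ⁻¹ = PC.transpose b a

module RingIdentities {c ℓ} (R : CommutativeRing c ℓ) where
  open import Tactic.RingSolver using (solve-∀)
  open import Tactic.RingSolver.Core.AlmostCommutativeRing using (AlmostCommutativeRing; fromCommutativeRing)
  open import Data.Maybe using (nothing)

  ACR = fromCommutativeRing R (λ _ → nothing)
  open AlmostCommutativeRing ACR

  [x+y]+[z+w]≈[x+z]+[y+w] : ∀ x y z w → (x + y) + (z + w) ≈ (x + z) + (y + w)
  [x+y]+[z+w]≈[x+z]+[y+w] = solve-∀ ACR

  [x+y]-[z+w]≈[x-z]+[y-w] : ∀ x y z w → (x + y) - (z + w) ≈ (x - z) + (y - w)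
  [x+y]-[z+w]≈[x-z]+[y-w] = solve-∀ ACR

  -x+-y≈-[x+y] : ∀ x y → - x + - y ≈ - (x + y)
  -x+-y≈-[x+y] = solve-∀ ACR

  -x-[-y]≈-[x-y] : ∀ x y → (- x) - (- y) ≈ - (x - y)
  -x-[-y]≈-[x-y] = solve-∀ ACR

  [x-y]-[z-w]≈[x-z]-[y-w] : ∀ x y z w → (x - y) - (z - w) ≈ (x - z) - (y - w)
  [x-y]-[z-w]≈[x-z]-[y-w] = solve-∀ ACR

  [x-y]-[z+[w-t]]≈[[x-w]-[y-t]]-z : ∀ x y z w t → (x - y) - (z + (w - t)) ≈ ((x - w) - (y - t)) - z
  [x-y]-[z+[w-t]]≈[[x-w]-[y-t]]-z = solve-∀ ACR

module _ {c ℓ} (R : CommutativeRing c ℓ) where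
  open CommutativeRing R renaming (Carrier to K) hiding (zero)
  open import Algebra.Properties.Ring ring using (-1*x≈-x; -0#≈0#)
  open import Algebra.Properties.AbelianGroup +-abelianGroup using (⁻¹-anti-homo‿-)
  open import Algebra.Properties.Group +-group using (//-rightDividesˡ; x∙y⁻¹≈ε⇒x≈y; x≈y⇒x∙y⁻¹≈ε)
  open import Relation.Binary.Reasoning.Setoid setoid

  open RingIdentities R

  Coeffs : ℕ → Set c
  Coeffs n = Vec ℕ n → K

  infix  4 _≋_
  infixl 6 _⊕_ _⊖_

  _≋_ : Coeffs n → Coeffs n → Set ℓ
  F ≋ G = ∀ e → F e ≈ G e

  𝟘 : Coeffs n
  𝟘 _ = 0#

  _⊕_ _⊖_ : Coeffs n → Coeffs n → Coeffs n
  (F ⊕ G) e = F e + G e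
  (F ⊖ G) e = F e - G e

  ⊝_ : Coeffs n → Coeffs n
  (⊝ F) e = - F e

  record IsAdditive (φ : Coeffs n → Coeffs n) : Set (c ⊔ ℓ) where
    field
      cong-≋ : ∀ {F G} → F ≋ G → φ F ≋ φ G
      homo-⊕ : ∀ F G → φ (F ⊕ G) ≋ φ F ⊕ φ G
      homo-⊝ : ∀ F → φ (⊝ F) ≋ ⊝ φ F

    homo-⊖ : ∀ F G → φ (F ⊖ G) ≋ φ F ⊖ φ G
    homo-⊖ F G e = trans (homo-⊕ F (⊝ G) e) (+-cong refl (homo-⊝ G e))

    homo-𝟘 : φ 𝟘 ≋ 𝟘
    homo-𝟘 e = begin
      φ 𝟘 e         ≈⟨ cong-≋ (λ _ → sym (-‿inverseʳ 0#)) e ⟩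
      φ (𝟘 ⊖ 𝟘) e   ≈⟨ homo-⊖ 𝟘 𝟘 e ⟩
      φ 𝟘 e - φ 𝟘 e ≈⟨ -‿inverseʳ _ ⟩
      0#            ∎

  ⟦_⟧ : Poly R n → Coeffs n
  ⟦ p ⟧ = coeff R p

  when : ∀ {A : Set} → Dec A → K → K
  when (yes _) a = a
  when (no _)  _ = 0#

  when-≢ : ∀ {A : Set} (d : Dec A) → ¬ A → ∀ a → when d a ≈ 0#
  when-≢ (yes x) ¬x _ = ⊥-elim (¬x x)
  when-≢ (no _)  _  _ = refl

  when-⇔ : ∀ {A B : Set} (dA : Dec A) (dB : Dec B) → (A → B) → (B → A) → ∀ a → when dA a ≈ when dB a
  when-⇔ (yes _) (yes _) _   _   _ = refl
  when-⇔ (no _)  (no _)  _   _   _ = refl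
  when-⇔ (yes x) (no ¬y) A→B _   _ = ⊥-elim (¬y (A→B x))
  when-⇔ (no ¬x) (yes y) _   B→A _ = ⊥-elim (¬x (B→A y))

  when-* : ∀ {A : Set} (d : Dec A) a b → when d (a * b) ≈ a * when d b
  when-* (yes _) a b = refl
  when-* (no _)  a b = sym (zeroʳ a)

  term : Vec ℕ n → K → Coeffs n
  term m a e = when (≡-dec ℕ._≟_ m e) a

  coeff-∷ : ∀ a m (p : Poly R n) → ⟦ (a , m) ∷ p ⟧ ≋ term m a ⊕ ⟦ p ⟧
  coeff-∷ a m p e with ≡-dec ℕ._≟_ m e
  ... | yes _ = refl
  ... | no  _ = sym (+-identityˡ _)

  coeff-++ : ∀ (p q : Poly R n) → ⟦ p ++ q ⟧ ≋ ⟦ p ⟧ ⊕ ⟦ q ⟧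
  coeff-++ []            q e = sym (+-identityˡ _)
  coeff-++ ((a , m) ∷ p) q e = begin
    ⟦ (a , m) ∷ (p ++ q) ⟧ e            ≈⟨ coeff-∷ a m (p ++ q) e ⟩
    term m a e + ⟦ p ++ q ⟧ e           ≈⟨ +-cong refl (coeff-++ p q e) ⟩
    term m a e + (⟦ p ⟧ e + ⟦ q ⟧ e)    ≈⟨ +-assoc _ _ _ ⟨
    (term m a e + ⟦ p ⟧ e) + ⟦ q ⟧ e    ≈⟨ +-cong (coeff-∷ a m p e) refl ⟨
    ⟦ (a , m) ∷ p ⟧ e + ⟦ q ⟧ e         ∎

  coeff-neg : ∀ (p : Poly R n) → ⟦ -P_ R p ⟧ ≋ ⊝ ⟦ p ⟧
  coeff-neg []            e = sym -0#≈0#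
  coeff-neg ((a , m) ∷ p) e = begin
    ⟦ (- a , m) ∷ -P_ R p ⟧ e        ≈⟨ coeff-∷ (- a) m (-P_ R p) e ⟩
    term m (- a) e + ⟦ -P_ R p ⟧ e   ≈⟨ +-cong (negate-term (≡-dec ℕ._≟_ m e)) (coeff-neg p e) ⟩
    - term m a e + - ⟦ p ⟧ e         ≈⟨ -x+-y≈-[x+y] _ _ ⟩
    - (term m a e + ⟦ p ⟧ e)         ≈⟨ -‿cong (coeff-∷ a m p e) ⟨
    - ⟦ (a , m) ∷ p ⟧ e              ∎
    where
    negate-term : ∀ {A : Set} (d : Dec A) → when d (- a) ≈ - when d a
    negate-term (yes _) = refl
    negate-term (no _)  = sym -0#≈0#

  coeff-sub : ∀ (p q : Poly R n) → ⟦ _-P_ R p q ⟧ ≋ ⟦ p ⟧ ⊖ ⟦ q ⟧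
  coeff-sub p q e = trans (coeff-++ p (-P_ R q) e) (+-cong refl (coeff-neg q e))

  ifPos : ℕ → K → K
  ifPos zero    _ = 0#
  ifPos (suc _) a = a

  -- The truncated subtraction in lower is harmless under ifPos.
  mulVar : Fin n → Coeffs n → Coeffs n
  mulVar a F e = ifPos (lookup e a) (F (lower a e))

  mulDiff : Fin n → Fin n → Coeffs n → Coeffs n
  mulDiff a b F = mulVar a F ⊖ mulVar b F

  mulVar-zero : ∀ (a : Fin n) F e → lookup e a ≡ zero → mulVar a F e ≈ 0#
  mulVar-zero a F e eq rewrite eq = refl

  mulVar-suc : ∀ (a : Fin n) F e {k} → lookup e a ≡ suc k → mulVar a F e ≈ F (lower a e)
  mulVar-suc a F e eq rewrite eq = refl

  mulVar-vanishes : ∀ (a : Fin n) F e → F (lower a e) ≈ 0# → mulVar a F e ≈ 0#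
  mulVar-vanishes a F e F≈0 with lookup e a
  ... | zero  = refl
  ... | suc _ = F≈0

  mulVar-additive : ∀ (a : Fin n) → IsAdditive (mulVar a)
  mulVar-additive a = record
    { cong-≋ = λ F≋G e → ifPos-cong (lookup e a) (F≋G (lower a e))
    ; homo-⊕ = λ F G e → ifPos-+ (lookup e a)
    ; homo-⊝ = λ F e → ifPos-neg (lookup e a)
    }
    where
    ifPos-cong : ∀ k {x y} → x ≈ y → ifPos k x ≈ ifPos k y
    ifPos-cong zero    _   = refl
    ifPos-cong (suc _) x≈y = x≈y
    ifPos-+ : ∀ k {x y} → ifPos k (x + y) ≈ ifPos k x + ifPos k y
    ifPos-+ zero    = sym (+-identityˡ 0#)
    ifPos-+ (suc _) = refl
    ifPos-neg : ∀ k {x} → ifPos k (- x) ≈ - ifPos k x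
    ifPos-neg zero    = sym -0#≈0#
    ifPos-neg (suc _) = refl

  mulDiff-additive : ∀ (a b : Fin n) → IsAdditive (mulDiff a b)
  mulDiff-additive a b = record
    { cong-≋ = λ F≋G e → +-cong (A.cong-≋ F≋G e) (-‿cong (B.cong-≋ F≋G e))
    ; homo-⊕ = λ F G e →
        trans (+-cong (A.homo-⊕ F G e) (-‿cong (B.homo-⊕ F G e))) ([x+y]-[z+w]≈[x-z]+[y-w] _ _ _ _)
    ; homo-⊝ = λ F e → trans (+-cong (A.homo-⊝ F e) (-‿cong (B.homo-⊝ F e))) (-x-[-y]≈-[x-y] _ _)
    }
    where
    module A = IsAdditive (mulVar-additive a)
    module B = IsAdditive (mulVar-additive b)

  mulDiff-swap : ∀ (a b : Fin n) F → mulDiff b a F ≋ ⊝ mulDiff a b F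
  mulDiff-swap a b F e = sym (⁻¹-anti-homo‿- (mulVar a F e) (mulVar b F e))

  mulVar-term : ∀ (a : Fin n) m q → mulVar a (term m q) ≋ term (raise a m) q
  mulVar-term a m q e with lookup e a in eq
  ... | zero  = sym (when-≢ (≡-dec ℕ._≟_ (raise a m) e) (lookup-suc-zero⇒≢ a (lookup-raise a m) eq) q)
  ... | suc _ = when-⇔ (≡-dec ℕ._≟_ m (lower a e)) (≡-dec ℕ._≟_ (raise a m) e)
                  (λ m≡ → ≡.trans (cong (raise a) m≡) (raise-lower a e eq))
                  (λ am≡e → ≡.trans (≡.sym (lower-raise a m)) (cong (lower a) am≡e)) q

  -- φ stands for a pattern lambda in the definition of _*P_, which cannot be named here.
  coeff-map-scale-shift : ∀ (φ : K × Vec ℕ n → K × Vec ℕ n) x (a : Fin n) →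
    (∀ b m → φ (b , m) ≡ (x * b , zipWith _+ℕ_ (updateAt (replicate n 0) a (λ _ → 1)) m)) →
    ∀ p → ⟦ map φ p ⟧ ≋ λ e → x * mulVar a ⟦ p ⟧ e
  coeff-map-scale-shift φ x a φ-def []            e = sym (trans (*-cong refl (homo-𝟘 e)) (zeroʳ x))
    where open IsAdditive (mulVar-additive a)
  coeff-map-scale-shift φ x a φ-def ((b , m) ∷ p) e = begin
    ⟦ φ (b , m) ∷ map φ p ⟧ e
      ≡⟨ cong (λ t → ⟦ t ∷ map φ p ⟧ e) (≡.trans (φ-def b m) (cong (x * b ,_) (zipWith-+-unit a m))) ⟩
    ⟦ (x * b , raise a m) ∷ map φ p ⟧ e
      ≈⟨ coeff-∷ (x * b) (raise a m) (map φ p) e ⟩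
    term (raise a m) (x * b) e + ⟦ map φ p ⟧ e
      ≈⟨ +-cong (when-* (≡-dec ℕ._≟_ (raise a m) e) x b) (coeff-map-scale-shift φ x a φ-def p e) ⟩
    x * term (raise a m) b e + x * mulVar a ⟦ p ⟧ e
      ≈⟨ distribˡ x _ _ ⟨
    x * (term (raise a m) b e + mulVar a ⟦ p ⟧ e)
      ≈⟨ *-cong refl (+-cong (mulVar-term a m b e) refl) ⟨
    x * (mulVar a (term m b) e + mulVar a ⟦ p ⟧ e)
      ≈⟨ *-cong refl (homo-⊕ (term m b) ⟦ p ⟧ e) ⟨
    x * mulVar a (term m b ⊕ ⟦ p ⟧) e
      ≈⟨ *-cong refl (cong-≋ (coeff-∷ b m p) e) ⟨
    x * mulVar a ⟦ (b , m) ∷ p ⟧ e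
      ∎
    where open IsAdditive (mulVar-additive a)

  coeff-varDiff-* : ∀ (a b : Fin n) p → ⟦ _*P_ R (_-P_ R (var R a) (var R b)) p ⟧ ≋ mulDiff a b ⟦ p ⟧
  coeff-varDiff-* a b p e = begin
    ⟦ _*P_ R (_-P_ R (var R a) (var R b)) p ⟧ e
      ≈⟨ coeff-++ (map _ p) _ e ⟩
    ⟦ map _ p ⟧ e + ⟦ map _ p ++ [] ⟧ e
      ≈⟨ +-cong refl (trans (coeff-++ (map _ p) [] e) (+-identityʳ _)) ⟩
    ⟦ map _ p ⟧ e + ⟦ map _ p ⟧ e
      ≈⟨ +-cong (coeff-map-scale-shift _ 1# a (λ _ _ → ≡.refl) p e)
                (coeff-map-scale-shift _ (- 1#) b (λ _ _ → ≡.refl) p e) ⟩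
    1# * mulVar a ⟦ p ⟧ e + - 1# * mulVar b ⟦ p ⟧ e
      ≈⟨ +-cong (*-identityˡ _) (-1*x≈-x _) ⟩
    mulDiff a b ⟦ p ⟧ e
      ∎

  -- Induction on the b-degree: F at e is the coefficient of t_a F at e + 1_a, which equals that of t_b F.
  mulDiff≋𝟘⇒≋𝟘 : ∀ {a b : Fin n} → a ≢ b → ∀ F → mulDiff a b F ≋ 𝟘 → F ≋ 𝟘
  mulDiff≋𝟘⇒≋𝟘 {a = a} {b} a≢b F tF≋0 e = go (lookup e b) e ≡.refl
    where
    lookup-b : ∀ e → lookup (raise a e) b ≡ lookup e b
    lookup-b = lookup-raise-≢ (a≢b ∘ ≡.sym)

    step : ∀ e → mulVar b F (raise a e) ≈ 0# → F e ≈ 0#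
    step e tbF≈0 = begin
      F e                                                 ≡⟨ cong F (lower-raise a e) ⟨
      F (lower a (raise a e))                             ≈⟨ mulVar-suc a F (raise a e) (lookup-raise a e) ⟨
      mulVar a F (raise a e)                              ≈⟨ //-rightDividesˡ _ _ ⟨
      mulDiff a b F (raise a e) + mulVar b F (raise a e)  ≈⟨ +-cong (tF≋0 (raise a e)) tbF≈0 ⟩
      0# + 0#                                             ≈⟨ +-identityˡ 0# ⟩
      0#                                                  ∎

    go : ∀ k e → lookup e b ≡ k → F e ≈ 0#
    go zero    e eq = step e (mulVar-zero b F (raise a e) (≡.trans (lookup-b e) eq))
    go (suc k) e eq = step e (trans (mulVar-suc b F (raise a e) (≡.trans (lookup-b e) eq))
      (go k (lower b (raise a e)) (≡.trans (lookup-lower b (raise a e)) (cong pred (≡.trans (lookup-b e) eq)))))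

  mulDiff-injective : ∀ {a b : Fin n} → a ≢ b → ∀ {F G} → mulDiff a b F ≋ mulDiff a b G → F ≋ G
  mulDiff-injective {a = a} {b} a≢b {F} {G} tF≋tG e = x∙y⁻¹≈ε⇒x≈y _ _ (mulDiff≋𝟘⇒≋𝟘 a≢b (F ⊖ G) t[F-G]≋𝟘 e)
    where
    open IsAdditive (mulDiff-additive a b)
    t[F-G]≋𝟘 : mulDiff a b (F ⊖ G) ≋ 𝟘
    t[F-G]≋𝟘 e = trans (homo-⊖ F G e) (x≈y⇒x∙y⁻¹≈ε (tF≋tG e))

  ifZero : ℕ → K → K
  ifZero zero    a = a
  ifZero (suc _) _ = 0#

  ifZero-cong : ∀ k {x y} → x ≈ y → ifZero k x ≈ ifZero k y
  ifZero-cong zero    x≈y = x≈y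
  ifZero-cong (suc _) _   = refl

  ifPos-ifZero : ∀ k j x → ifPos k (ifZero j x) ≈ ifZero j (ifPos k x)
  ifPos-ifZero zero    zero    _ = refl
  ifPos-ifZero zero    (suc _) _ = refl
  ifPos-ifZero (suc _) _       _ = refl

  module Specialise {γ δ : Fin n} (γ≢δ : γ ≢ δ) where

    δ≢γ : δ ≢ γ
    δ≢γ = γ≢δ ∘ ≡.sym

    shiftToγ : Vec ℕ n → Vec ℕ n
    shiftToγ e = raise γ (lower δ e)

    lookup-shiftToγ-γ : ∀ e → lookup (shiftToγ e) γ ≡ suc (lookup e γ)
    lookup-shiftToγ-γ e = ≡.trans (lookup-raise γ (lower δ e)) (cong suc (lookup-lower-≢ γ≢δ e))

    lookup-shiftToγ-δ-pred : ∀ e {N} → lookup e δ ≡ suc N → lookup (shiftToγ e) δ ≡ N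
    lookup-shiftToγ-δ-pred e eq =
      ≡.trans (lookup-raise-≢ δ≢γ (lower δ e)) (≡.trans (lookup-lower δ e) (cong pred eq))

    lower-δ-shiftToγ : ∀ e → lower δ (shiftToγ e) ≡ shiftToγ (lower δ e)
    lower-δ-shiftToγ e = updateAt-commutes δ γ δ≢γ (lower δ e)

    diagonalSum : Coeffs n → Vec ℕ n → ℕ → K
    diagonalSum F e zero    = F e
    diagonalSum F e (suc N) = F e + diagonalSum F (shiftToγ e) N

    -- Coefficients of F after substituting t_γ := t_δ: the monomial t^e with e_γ = 0
    -- collects every t^e′ with e′_γ + e′_δ = e_δ and e′ = e elsewhere.
    specialise : Coeffs n → Coeffs n
    specialise F e = ifZero (lookup e γ) (diagonalSum F e (lookup e δ))

    specialise-additive : IsAdditive specialise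
    specialise-additive = record
      { cong-≋ = λ F≋G e → ifZero-cong (lookup e γ) (sum-cong F≋G e (lookup e δ))
      ; homo-⊕ = λ F G e → trans (ifZero-cong (lookup e γ) (sum-⊕ F G e (lookup e δ))) (ifZero-+ (lookup e γ))
      ; homo-⊝ = λ F e → trans (ifZero-cong (lookup e γ) (sum-⊝ F e (lookup e δ))) (ifZero-neg (lookup e γ))
      }
      where
      ifZero-+ : ∀ k {x y} → ifZero k (x + y) ≈ ifZero k x + ifZero k y
      ifZero-+ zero    = refl
      ifZero-+ (suc _) = sym (+-identityˡ 0#)
      ifZero-neg : ∀ k {x} → ifZero k (- x) ≈ - ifZero k x
      ifZero-neg zero    = refl
      ifZero-neg (suc _) = sym -0#≈0#
      sum-cong : ∀ {F G} → F ≋ G → ∀ e N → diagonalSum F e N ≈ diagonalSum G e N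
      sum-cong F≋G e zero    = F≋G e
      sum-cong F≋G e (suc N) = +-cong (F≋G e) (sum-cong F≋G (shiftToγ e) N)
      sum-⊕ : ∀ F G e N → diagonalSum (F ⊕ G) e N ≈ diagonalSum F e N + diagonalSum G e N
      sum-⊕ F G e zero    = refl
      sum-⊕ F G e (suc N) = trans (+-cong refl (sum-⊕ F G (shiftToγ e) N)) ([x+y]+[z+w]≈[x+z]+[y+w] _ _ _ _)
      sum-⊝ : ∀ F e N → diagonalSum (⊝ F) e N ≈ - diagonalSum F e N
      sum-⊝ F e zero    = refl
      sum-⊝ F e (suc N) = trans (+-cong refl (sum-⊝ F (shiftToγ e) N)) (-x+-y≈-[x+y] _ _)

    specialise-off : ∀ F e {k} → lookup e γ ≡ suc k → specialise F e ≈ 0#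
    specialise-off F e eq rewrite eq = refl

    specialise-free : ∀ F → (∀ e {k} → lookup e γ ≡ suc k → F e ≈ 0#) → specialise F ≋ F
    specialise-free F free e with lookup e γ in eq
    ... | suc _ = sym (free e eq)
    ... | zero  = first-term (lookup e δ)
      where
      shifted : ∀ N e → diagonalSum F (shiftToγ e) N ≈ 0#
      shifted zero    e = free (shiftToγ e) (lookup-shiftToγ-γ e)
      shifted (suc N) e =
        trans (+-cong (free (shiftToγ e) (lookup-shiftToγ-γ e)) (shifted N (shiftToγ e))) (+-identityˡ 0#)
      first-term : ∀ N → diagonalSum F e N ≈ F e
      first-term zero    = refl
      first-term (suc N) = trans (+-cong refl (shifted N e)) (+-identityʳ _)

    mulVar-γ-shiftToγ : ∀ F e → mulVar γ F (shiftToγ e) ≈ F (lower δ e)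
    mulVar-γ-shiftToγ F e =
      trans (mulVar-suc γ F (shiftToγ e) (lookup-shiftToγ-γ e)) (reflexive (cong F (lower-raise γ (lower δ e))))

    module _ {α : Fin n} (α≢γ : α ≢ γ) (α≢δ : α ≢ δ) where

      mulVar-shiftToγ : ∀ F e → mulVar α F (shiftToγ e) ≡ mulVar α (F ∘ shiftToγ) e
      mulVar-shiftToγ F e = ≡.cong₂ (λ k e′ → ifPos k (F e′))
        (≡.trans (lookup-raise-≢ α≢γ (lower δ e)) (lookup-lower-≢ α≢δ e))
        (≡.trans (updateAt-commutes α γ α≢γ (lower δ e)) (cong (raise γ) (updateAt-commutes α δ α≢δ e)))

      sum-mulVar-other : ∀ F N e → diagonalSum (mulVar α F) e N ≈ mulVar α (λ e′ → diagonalSum F e′ N) e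
      sum-mulVar-other F zero    e = refl
      sum-mulVar-other F (suc N) e = begin
        mulVar α F e + diagonalSum (mulVar α F) (shiftToγ e) N
          ≈⟨ +-cong refl (sum-mulVar-other F N (shiftToγ e)) ⟩
        mulVar α F e + mulVar α (λ e′ → diagonalSum F e′ N) (shiftToγ e)
          ≡⟨ cong (mulVar α F e +_) (mulVar-shiftToγ (λ e′ → diagonalSum F e′ N) e) ⟩
        mulVar α F e + mulVar α (λ e′ → diagonalSum F (shiftToγ e′) N) e
          ≈⟨ homo-⊕ F (λ e′ → diagonalSum F (shiftToγ e′) N) e ⟨
        mulVar α (λ e′ → diagonalSum F e′ (suc N)) e
          ∎
        where open IsAdditive (mulVar-additive α)

      specialise-mulVar-other : ∀ F → specialise (mulVar α F) ≋ mulVar α (specialise F)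
      specialise-mulVar-other F e = begin
        ifZero (lookup e γ) (diagonalSum (mulVar α F) e (lookup e δ))
          ≈⟨ ifZero-cong (lookup e γ) (sum-mulVar-other F (lookup e δ) e) ⟩
        ifZero (lookup e γ) (ifPos (lookup e α) (diagonalSum F (lower α e) (lookup e δ)))
          ≈⟨ ifPos-ifZero (lookup e α) (lookup e γ) _ ⟨
        ifPos (lookup e α) (ifZero (lookup e γ) (diagonalSum F (lower α e) (lookup e δ)))
          ≡⟨ ≡.cong₂ (λ j k → ifPos (lookup e α) (ifZero j (diagonalSum F (lower α e) k)))
                      (lookup-lower-≢ (α≢γ ∘ ≡.sym) e) (lookup-lower-≢ (α≢δ ∘ ≡.sym) e) ⟨
        mulVar α (specialise F) e
          ∎

    sum-mulVar-δ : ∀ F N e → lookup e δ ≡ suc N →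
                   diagonalSum (mulVar δ F) e (suc N) ≈ diagonalSum F (lower δ e) N
    sum-mulVar-δ F zero    e eq = begin
      mulVar δ F e + mulVar δ F (shiftToγ e)
        ≈⟨ +-cong (mulVar-suc δ F e eq) (mulVar-zero δ F (shiftToγ e) (lookup-shiftToγ-δ-pred e eq)) ⟩
      F (lower δ e) + 0#
        ≈⟨ +-identityʳ _ ⟩
      F (lower δ e)
        ∎
    sum-mulVar-δ F (suc N) e eq = begin
      mulVar δ F e + diagonalSum (mulVar δ F) (shiftToγ e) (suc N)
        ≈⟨ +-cong (mulVar-suc δ F e eq) (sum-mulVar-δ F N (shiftToγ e) (lookup-shiftToγ-δ-pred e eq)) ⟩
      F (lower δ e) + diagonalSum F (lower δ (shiftToγ e)) N
        ≡⟨ cong (λ e′ → F (lower δ e) + diagonalSum F e′ N) (lower-δ-shiftToγ e) ⟩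
      diagonalSum F (lower δ e) (suc N)
        ∎

    specialise-mulVar-δ : ∀ F → specialise (mulVar δ F) ≋ mulVar δ (specialise F)
    specialise-mulVar-δ F e with lookup e δ in eq
    ... | zero  = trans (ifZero-cong (lookup e γ) (mulVar-zero δ F e eq)) (ifZero-zero (lookup e γ))
      where
      ifZero-zero : ∀ k → ifZero k 0# ≈ 0#
      ifZero-zero zero    = refl
      ifZero-zero (suc _) = refl
    ... | suc N = trans (ifZero-cong (lookup e γ) (sum-mulVar-δ F N e eq))
      (reflexive (≡.cong₂ (λ j k → ifZero j (diagonalSum F (lower δ e) k))
        (≡.sym (lookup-lower-≢ γ≢δ e)) (≡.sym (≡.trans (lookup-lower δ e) (cong pred eq)))))

    sum-mulVar-γ : ∀ F N e → diagonalSum (mulVar γ F) (shiftToγ e) N ≈ diagonalSum F (lower δ e) N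
    sum-mulVar-γ F zero    e = mulVar-γ-shiftToγ F e
    sum-mulVar-γ F (suc N) e = begin
      mulVar γ F (shiftToγ e) + diagonalSum (mulVar γ F) (shiftToγ (shiftToγ e)) N
        ≈⟨ +-cong (mulVar-γ-shiftToγ F e) (sum-mulVar-γ F N (shiftToγ e)) ⟩
      F (lower δ e) + diagonalSum F (lower δ (shiftToγ e)) N
        ≡⟨ cong (λ e′ → F (lower δ e) + diagonalSum F e′ N) (lower-δ-shiftToγ e) ⟩
      diagonalSum F (lower δ e) (suc N)
        ∎

    specialise-mulVar-γ : ∀ F → specialise (mulVar γ F) ≋ mulVar δ (specialise F)
    specialise-mulVar-γ F e with lookup e γ in eqγ
    ... | suc _ = sym (mulVar-vanishes δ (specialise F) e
                        (specialise-off F (lower δ e) (≡.trans (lookup-lower-≢ γ≢δ e) eqγ)))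
    ... | zero with lookup e δ in eqδ
    ...   | zero  = mulVar-zero γ F e eqγ
    ...   | suc N = begin
      mulVar γ F e + diagonalSum (mulVar γ F) (shiftToγ e) N
        ≈⟨ +-cong (mulVar-zero γ F e eqγ) (sum-mulVar-γ F N e) ⟩
      0# + diagonalSum F (lower δ e) N
        ≈⟨ +-identityˡ _ ⟩
      diagonalSum F (lower δ e) N
        ≡⟨ ≡.cong₂ (λ j k → ifZero j (diagonalSum F (lower δ e) k))
                    (≡.trans (lookup-lower-≢ γ≢δ e) eqγ) (≡.trans (lookup-lower δ e) (cong pred eqδ)) ⟨
      specialise F (lower δ e)
        ∎

    merge : Fin n → Fin n
    merge α with α ≟F γ
    ... | yes _ = δ
    ... | no  _ = α

    specialise-mulVar : ∀ α F → specialise (mulVar α F) ≋ mulVar (merge α) (specialise F)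
    specialise-mulVar α F with α ≟F γ
    ... | yes ≡.refl = specialise-mulVar-γ F
    ... | no  α≢γ with α ≟F δ
    ...   | yes ≡.refl = specialise-mulVar-δ F
    ...   | no  α≢δ    = specialise-mulVar-other α≢γ α≢δ F

    specialise-mulDiff : ∀ α β F → specialise (mulDiff α β F) ≋ mulDiff (merge α) (merge β) (specialise F)
    specialise-mulDiff α β F e =
      trans (homo-⊖ (mulVar α F) (mulVar β F) e)
            (+-cong (specialise-mulVar α F e) (-‿cong (specialise-mulVar β F e)))
      where open IsAdditive specialise-additive

    specialise-mulDiff-self : ∀ F → specialise (mulDiff γ δ F) ≋ 𝟘
    specialise-mulDiff-self F e = begin
      specialise (mulDiff γ δ F) e
        ≈⟨ homo-⊖ (mulVar γ F) (mulVar δ F) e ⟩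
      specialise (mulVar γ F) e - specialise (mulVar δ F) e
        ≈⟨ +-cong (specialise-mulVar-γ F e) (-‿cong (specialise-mulVar-δ F e)) ⟩
      mulVar δ (specialise F) e - mulVar δ (specialise F) e
        ≈⟨ -‿inverseʳ _ ⟩
      0#
        ∎
      where open IsAdditive specialise-additive

    merge-≢ : ∀ {α β} → α ≢ β → ¬ (α ≡ γ × β ≡ δ) → ¬ (β ≡ γ × α ≡ δ) → merge α ≢ merge β
    merge-≢ {α} {β} α≢β ¬γδ ¬δγ with α ≟F γ | β ≟F γ
    ... | yes α≡γ | yes β≡γ = λ _ → α≢β (≡.trans α≡γ (≡.sym β≡γ))
    ... | yes α≡γ | no  _   = λ δ≡β → ¬γδ (α≡γ , ≡.sym δ≡β)
    ... | no  _   | yes β≡γ = λ α≡δ → ¬δγ (β≡γ , α≡δ)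
    ... | no  _   | no  _   = α≢β

    specialise-vanishes : ∀ {α β} → α ≢ β → ¬ (α ≡ γ × β ≡ δ) → ¬ (β ≡ γ × α ≡ δ) →
                          ∀ F W → mulDiff α β F ≋ mulDiff γ δ W → specialise F ≋ 𝟘
    specialise-vanishes {α} {β} α≢β ¬γδ ¬δγ F W tF≋tW =
      mulDiff≋𝟘⇒≋𝟘 (merge-≢ α≢β ¬γδ ¬δγ) (specialise F) λ e → begin
      mulDiff (merge α) (merge β) (specialise F) e  ≈⟨ specialise-mulDiff α β F e ⟨
      specialise (mulDiff α β F) e                  ≈⟨ cong-≋ tF≋tW e ⟩
      specialise (mulDiff γ δ W) e                  ≈⟨ specialise-mulDiff-self W e ⟩
      0#                                            ∎
      where open IsAdditive specialise-additive

    quotientTerm : ℕ → K → Vec ℕ n → Poly R n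
    quotientTerm zero    q m = []
    quotientTerm (suc k) q m = (q , lower γ m) ∷ quotientTerm k q (raise δ (lower γ m))

    quotient : Poly R n → Poly R n
    quotient []            = []
    quotient ((q , m) ∷ Y) = quotientTerm (lookup m γ) q m ++ quotient Y

    -- (t_γ − t_δ) · quotientTerm k q m = q t^m − q t^(m − k·1_γ + k·1_δ), and for k = m_γ the
    -- last term has γ-degree zero.
    quotientTerm-correct : ∀ k q m → lookup m γ ≡ k → ∀ e {j} → lookup e γ ≡ suc j →
                           mulDiff γ δ ⟦ quotientTerm k q m ⟧ e ≈ term m q e
    quotientTerm-correct zero q m eq e eqe =
      trans (homo-𝟘 e) (sym (when-≢ (≡-dec ℕ._≟_ m e) (lookup-suc-zero⇒≢ γ eqe eq ∘ ≡.sym) q))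
      where open IsAdditive (mulDiff-additive γ δ)
    quotientTerm-correct (suc k) q m eq e eqe = begin
      mulDiff γ δ ⟦ (q , m′) ∷ Q ⟧ e
        ≈⟨ cong-≋ (coeff-∷ q m′ Q) e ⟩
      mulDiff γ δ (term m′ q ⊕ ⟦ Q ⟧) e
        ≈⟨ homo-⊕ (term m′ q) ⟦ Q ⟧ e ⟩
      mulDiff γ δ (term m′ q) e + mulDiff γ δ ⟦ Q ⟧ e
        ≈⟨ +-cong (+-cong (mulVar-term γ m′ q e) (-‿cong (mulVar-term δ m′ q e)))
                  (quotientTerm-correct k q m″ eq″ e eqe) ⟩
      (term (raise γ m′) q e - term m″ q e) + term m″ q e
        ≈⟨ //-rightDividesˡ _ _ ⟩
      term (raise γ m′) q e
        ≡⟨ cong (λ v → term v q e) (raise-lower γ m eq) ⟩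
      term m q e
        ∎
      where
      open IsAdditive (mulDiff-additive γ δ)
      m′ = lower γ m
      m″ = raise δ m′
      Q = quotientTerm k q m″
      eq″ : lookup m″ γ ≡ k
      eq″ = ≡.trans (lookup-raise-≢ γ≢δ m′) (≡.trans (lookup-lower γ m) (cong pred eq))

    quotient-correct : ∀ Y e {j} → lookup e γ ≡ suc j → mulDiff γ δ ⟦ quotient Y ⟧ e ≈ ⟦ Y ⟧ e
    quotient-correct []            e eqe = homo-𝟘 e
      where open IsAdditive (mulDiff-additive γ δ)
    quotient-correct ((q , m) ∷ Y) e eqe = begin
      mulDiff γ δ ⟦ Q ++ quotient Y ⟧ e
        ≈⟨ cong-≋ (coeff-++ Q (quotient Y)) e ⟩
      mulDiff γ δ (⟦ Q ⟧ ⊕ ⟦ quotient Y ⟧) e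
        ≈⟨ homo-⊕ ⟦ Q ⟧ ⟦ quotient Y ⟧ e ⟩
      mulDiff γ δ ⟦ Q ⟧ e + mulDiff γ δ ⟦ quotient Y ⟧ e
        ≈⟨ +-cong (quotientTerm-correct (lookup m γ) q m ≡.refl e eqe) (quotient-correct Y e eqe) ⟩
      term m q e + ⟦ Y ⟧ e
        ≈⟨ coeff-∷ q m Y e ⟨
      ⟦ (q , m) ∷ Y ⟧ e
        ∎
      where
      open IsAdditive (mulDiff-additive γ δ)
      Q = quotientTerm (lookup m γ) q m

    quotient-exact : ∀ Y → specialise ⟦ Y ⟧ ≋ 𝟘 → mulDiff γ δ ⟦ quotient Y ⟧ ≋ ⟦ Y ⟧
    quotient-exact Y σY≋𝟘 e = sym (x∙y⁻¹≈ε⇒x≈y _ _ (begin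
      Rem e
        ≈⟨ specialise-free Rem Rem-free e ⟨
      specialise Rem e
        ≈⟨ homo-⊖ ⟦ Y ⟧ (mulDiff γ δ ⟦ quotient Y ⟧) e ⟩
      specialise ⟦ Y ⟧ e - specialise (mulDiff γ δ ⟦ quotient Y ⟧) e
        ≈⟨ +-cong (σY≋𝟘 e) (-‿cong (specialise-mulDiff-self ⟦ quotient Y ⟧ e)) ⟩
      0# - 0#
        ≈⟨ -‿inverseʳ 0# ⟩
      0#
        ∎))
      where
      open IsAdditive specialise-additive
      Rem : Coeffs n
      Rem = ⟦ Y ⟧ ⊖ mulDiff γ δ ⟦ quotient Y ⟧
      Rem-free : ∀ e {k} → lookup e γ ≡ suc k → Rem e ≈ 0#
      Rem-free e eq = x≈y⇒x∙y⁻¹≈ε (sym (quotient-correct Y e eq))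

  difference : H R n → Fin n → Fin n → Permutation′ n → Poly R n
  difference f j k v = _-P_ R (app f v) (star R f (transpose j k) v)

  coeff-difference : ∀ (f : H R n) j k v →
                     ⟦ difference f j k v ⟧ ≋ ⟦ app f v ⟧ ⊖ ⟦ star R f (transpose j k) v ⟧
  coeff-difference f j k v = coeff-sub (app f v) (star R f (transpose j k) v)

  coeff-DivRel : ∀ {j k : Fin n} f g → DivRel R j k f g → ∀ v →
                 ⟦ app f v ⟧ ⊖ ⟦ star R f (transpose j k) v ⟧ ≋ mulDiff (v ⟨$⟩ʳ j) (v ⟨$⟩ʳ k) ⟦ app g v ⟧
  coeff-DivRel {j = j} {k} f g rel v e = begin
    ⟦ app f v ⟧ e - ⟦ star R f (transpose j k) v ⟧ e     ≈⟨ coeff-difference f j k v e ⟨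
    ⟦ difference f j k v ⟧ e                             ≈⟨ rel v e ⟩
    ⟦ _*P_ R (_-P_ R (x R j v) (x R k v)) (app g v) ⟧ e
      ≈⟨ coeff-varDiff-* (v ⟨$⟩ʳ j) (v ⟨$⟩ʳ k) (app g v) e ⟩
    mulDiff (v ⟨$⟩ʳ j) (v ⟨$⟩ʳ k) ⟦ app g v ⟧ e          ∎

  DivRel-unique : ∀ {j k : Fin n} → j ≢ k → ∀ f g g′ → DivRel R j k f g → DivRel R j k f g′ →
                  ∀ v → _≈P_ R (app g v) (app g′ v)
  DivRel-unique j≢k f g g′ rel rel′ v = mulDiff-injective (j≢k ∘ permutation-injective v) λ e →
    trans (sym (coeff-DivRel f g rel v e)) (coeff-DivRel f g′ rel′ v e)

  specialise≋𝟘⇒Cond : ∀ {j k : Fin n} (j≢k : j ≢ k) (g : H R n) →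
    (∀ v → Specialise.specialise (j≢k ∘ permutation-injective v) ⟦ difference g j k v ⟧ ≋ 𝟘) → Cond R j k g
  specialise≋𝟘⇒Cond {n = n} {j} {k} j≢k g σΔ≋𝟘 = h , h-rel
    where
    vj≢vk : ∀ v → v ⟨$⟩ʳ j ≢ v ⟨$⟩ʳ k
    vj≢vk v = j≢k ∘ permutation-injective v

    quotientAt : Permutation′ n → Poly R n
    quotientAt v = Specialise.quotient (vj≢vk v) (difference g j k v)

    exact : ∀ v → mulDiff (v ⟨$⟩ʳ j) (v ⟨$⟩ʳ k) ⟦ quotientAt v ⟧ ≋ ⟦ difference g j k v ⟧
    exact v = Specialise.quotient-exact (vj≢vk v) (difference g j k v) (σΔ≋𝟘 v)

    quotientAt-resp : ∀ {v w} → v Perm.≈ w → _≈P_ R (quotientAt v) (quotientAt w)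
    quotientAt-resp {v} {w} v≈w = mulDiff-injective (vj≢vk v) λ e → begin
      mulDiff (v ⟨$⟩ʳ j) (v ⟨$⟩ʳ k) ⟦ quotientAt v ⟧ e  ≈⟨ exact v e ⟩
      ⟦ difference g j k v ⟧ e                           ≈⟨ coeff-difference g j k v e ⟩
      ⟦ app g v ⟧ e - ⟦ star R g (transpose j k) v ⟧ e
        ≈⟨ +-cong (resp g v≈w e) (-‿cong (resp g (v≈w ∘ PC.transpose k j) e)) ⟩
      ⟦ app g w ⟧ e - ⟦ star R g (transpose j k) w ⟧ e   ≈⟨ coeff-difference g j k w e ⟨
      ⟦ difference g j k w ⟧ e                           ≈⟨ exact w e ⟨
      mulDiff (w ⟨$⟩ʳ j) (w ⟨$⟩ʳ k) ⟦ quotientAt w ⟧ e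
        ≡⟨ ≡.cong₂ (λ α β → mulDiff α β ⟦ quotientAt w ⟧ e) (v≈w j) (v≈w k) ⟨
      mulDiff (v ⟨$⟩ʳ j) (v ⟨$⟩ʳ k) ⟦ quotientAt w ⟧ e  ∎

    h : H R n
    h = record { app = quotientAt ; resp = quotientAt-resp }

    h-rel : DivRel R j k g h
    h-rel v e = sym (trans (coeff-varDiff-* (v ⟨$⟩ʳ j) (v ⟨$⟩ʳ k) (quotientAt v) e) (exact v e))

  mulVar-sub-transpose : ∀ (π : Fin n → Fin n) (j k y : Fin n) G →
    ∃ λ Z → mulVar (π y) G ⊖ mulVar (π (PC.transpose k j y)) G ≋ mulDiff (π j) (π k) Z
  mulVar-sub-transpose π j k y G = cases (y ≟F j) (y ≟F k)
    where
    t[π_]G : Fin _ → Coeffs _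
    t[π z ]G = mulVar (π z) G

    cases : Dec (y ≡ j) → Dec (y ≡ k) → ∃ λ Z → t[π y ]G ⊖ t[π PC.transpose k j y ]G ≋ mulDiff (π j) (π k) Z
    cases (yes ≡.refl) _ = G , λ e →
      reflexive (cong (λ z → t[π y ]G e - t[π z ]G e) (transpose-matchʳ k y))
    cases (no _) (yes ≡.refl) = ⊝ G , λ e → begin
      t[π y ]G e - t[π PC.transpose y j y ]G e  ≡⟨ cong (λ z → t[π y ]G e - t[π z ]G e) (transpose-matchˡ y j) ⟩
      mulDiff (π y) (π j) G e                   ≈⟨ mulDiff-swap (π j) (π y) G e ⟩
      - mulDiff (π j) (π y) G e                 ≈⟨ IsAdditive.homo-⊝ (mulDiff-additive (π j) (π y)) G e ⟨
      mulDiff (π j) (π y) (⊝ G) e               ∎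
    cases (no y≢j) (no y≢k) = 𝟘 , λ e → begin
      t[π y ]G e - t[π PC.transpose k j y ]G e  ≡⟨ cong (λ z → t[π y ]G e - t[π z ]G e) (transpose-other y≢k y≢j) ⟩
      t[π y ]G e - t[π y ]G e                   ≈⟨ -‿inverseʳ _ ⟩
      0#                                        ≈⟨ IsAdditive.homo-𝟘 (mulDiff-additive (π j) (π k)) e ⟨
      mulDiff (π j) (π k) 𝟘 e                   ∎

  mulDiff-sub-transpose : ∀ (π : Fin n → Fin n) (j k a b : Fin n) G → ∃ λ Z →
    mulDiff (π a) (π b) G ⊖ mulDiff (π (PC.transpose k j a)) (π (PC.transpose k j b)) G ≋ mulDiff (π j) (π k) Z
  mulDiff-sub-transpose π j k a b G = Za ⊖ Zb , λ e → begin
    (mulVar (π a) G e - mulVar (π b) G e) - (mulVar (π (τ a)) G e - mulVar (π (τ b)) G e)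
      ≈⟨ [x-y]-[z-w]≈[x-z]-[y-w] _ _ _ _ ⟩
    (mulVar (π a) G e - mulVar (π (τ a)) G e) - (mulVar (π b) G e - mulVar (π (τ b)) G e)
      ≈⟨ +-cong (proj₂ (mulVar-sub-transpose π j k a G) e)
                (-‿cong (proj₂ (mulVar-sub-transpose π j k b G) e)) ⟩
    mulDiff (π j) (π k) Za e - mulDiff (π j) (π k) Zb e
      ≈⟨ IsAdditive.homo-⊖ (mulDiff-additive (π j) (π k)) Za Zb e ⟨
    mulDiff (π j) (π k) (Za ⊖ Zb) e
      ∎
    where
    τ = PC.transpose k j
    Za = proj₁ (mulVar-sub-transpose π j k a G)
    Zb = proj₁ (mulVar-sub-transpose π j k b G)

  ∂-invariant : ∀ {a b : Fin n} → a ≢ b → ∀ f g → DivRel R a b f g →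
                ∀ v → ⟦ app g v ⟧ ≋ ⟦ star R g (transpose a b) v ⟧
  ∂-invariant {a = a} {b} a≢b f g ∂fg v = mulDiff-injective (a≢b ∘ permutation-injective v) λ e → begin
    mulDiff (v ⟨$⟩ʳ a) (v ⟨$⟩ʳ b) ⟦ app g v ⟧ e    ≈⟨ coeff-DivRel f g ∂fg v e ⟨
    ⟦ app f v ⟧ e - ⟦ app f u ⟧ e                  ≈⟨ +-cong (resp f u·s≈v e) refl ⟨
    ⟦ star R f sab u ⟧ e - ⟦ app f u ⟧ e           ≈⟨ ⁻¹-anti-homo‿- _ _ ⟨
    - (⟦ app f u ⟧ e - ⟦ star R f sab u ⟧ e)       ≈⟨ -‿cong (coeff-DivRel f g ∂fg u e) ⟩
    - mulDiff (u ⟨$⟩ʳ a) (u ⟨$⟩ʳ b) ⟦ app g u ⟧ e  ≈⟨ mulDiff-swap _ _ ⟦ app g u ⟧ e ⟨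
    mulDiff (u ⟨$⟩ʳ b) (u ⟨$⟩ʳ a) ⟦ app g u ⟧ e
      ≡⟨ ≡.cong₂ (λ α β → mulDiff α β ⟦ app g u ⟧ e)
                 (cong (v ⟨$⟩ʳ_) (transpose-matchˡ b a)) (cong (v ⟨$⟩ʳ_) (transpose-matchʳ b a)) ⟩
    mulDiff (v ⟨$⟩ʳ a) (v ⟨$⟩ʳ b) ⟦ app g u ⟧ e    ∎
    where
    sab = transpose a b
    u = _·_ R v (flip sab)
    u·s≈v : _·_ R u (flip sab) Perm.≈ v
    u·s≈v y = cong (v ⟨$⟩ʳ_) (transpose-involutive b a y)

  -- With w = v τ⁻¹, u = v s⁻¹ and p = w s⁻¹, (x_a − x_b)(g − g * τ) at v splits into f(v) − f(w) and
  -- f(u) − f(p), divisible by condition τ at v and by condition s τ s at u, and a multiple of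
  -- (x_a − x_b) − (x_a − x_b) * τ, divisible because τ only moves j and k.
  ∂-difference-divisible : ∀ {a b j k : Fin n} f g → DivRel R a b f g →
    Cond R j k f → Cond R (PC.transpose a b j) (PC.transpose a b k) f → ∀ v →
    ∃ λ W → mulDiff (v ⟨$⟩ʳ a) (v ⟨$⟩ʳ b) ⟦ difference g j k v ⟧ ≋ mulDiff (v ⟨$⟩ʳ j) (v ⟨$⟩ʳ k) W
  ∂-difference-divisible {a = a} {b} {j} {k} f g ∂fg (A , condτ) (B , condsτs) v = W , λ e → begin
    Dab ⟦ difference g j k v ⟧ e                       ≈⟨ Dab.cong-≋ (coeff-difference g j k v) e ⟩
    Dab (⟦ app g v ⟧ ⊖ ⟦ app g w ⟧) e                  ≈⟨ Dab.homo-⊖ ⟦ app g v ⟧ ⟦ app g w ⟧ e ⟩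
    Dab ⟦ app g v ⟧ e - Dab ⟦ app g w ⟧ e
      ≈⟨ +-cong (sym (coeff-DivRel f g ∂fg v e))
                (-‿cong (trans (sym (//-rightDividesˡ _ _)) (+-cong (proj₂ shift e) (sym (coeff-DivRel f g ∂fg w e))))) ⟩
    (F v e - F u e) - (Djk Z e + (F w e - F p e))
      ≈⟨ [x-y]-[z+[w-t]]≈[[x-w]-[y-t]]-z _ _ _ _ _ ⟩
    ((F v e - F w e) - (F u e - F p e)) - Djk Z e
      ≈⟨ +-cong (+-cong (coeff-DivRel f A condτ v e) (-‿cong (sτs-at-u e))) refl ⟩
    (Djk ⟦ app A v ⟧ e - Djk ⟦ app B u ⟧ e) - Djk Z e
      ≈⟨ +-cong (Djk.homo-⊖ ⟦ app A v ⟧ ⟦ app B u ⟧ e) refl ⟨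
    Djk (⟦ app A v ⟧ ⊖ ⟦ app B u ⟧) e - Djk Z e
      ≈⟨ Djk.homo-⊖ (⟦ app A v ⟧ ⊖ ⟦ app B u ⟧) Z e ⟨
    Djk W e
      ∎
    where
    σ = PC.transpose a b
    w = _·_ R v (flip (transpose j k))
    u = _·_ R v (flip (transpose a b))
    p = _·_ R w (flip (transpose a b))
    F : Permutation′ _ → Coeffs _
    F v′ = ⟦ app f v′ ⟧
    Dab = mulDiff (v ⟨$⟩ʳ a) (v ⟨$⟩ʳ b)
    Djk = mulDiff (v ⟨$⟩ʳ j) (v ⟨$⟩ʳ k)
    module Dab = IsAdditive (mulDiff-additive (v ⟨$⟩ʳ a) (v ⟨$⟩ʳ b))
    module Djk = IsAdditive (mulDiff-additive (v ⟨$⟩ʳ j) (v ⟨$⟩ʳ k))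
    shift = mulDiff-sub-transpose (v ⟨$⟩ʳ_) j k a b ⟦ app g w ⟧
    Z = proj₁ shift
    W = (⟦ app A v ⟧ ⊖ ⟦ app B u ⟧) ⊖ Z
    sτs-at-u : ∀ e → F u e - F p e ≈ Djk ⟦ app B u ⟧ e
    sτs-at-u e = begin
      F u e - F p e
        ≈⟨ +-cong refl (-‿cong (resp f (cong (v ⟨$⟩ʳ_) ∘ transpose-conj-transpose a b j k) e)) ⟨
      F u e - ⟦ star R f (transpose (σ j) (σ k)) u ⟧ e   ≈⟨ coeff-DivRel f B condsτs u e ⟩
      mulDiff (u ⟨$⟩ʳ σ j) (u ⟨$⟩ʳ σ k) ⟦ app B u ⟧ e
        ≡⟨ ≡.cong₂ (λ α β → mulDiff α β ⟦ app B u ⟧ e)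
                   (cong (v ⟨$⟩ʳ_) (PC.transpose-inverse b a)) (cong (v ⟨$⟩ʳ_) (PC.transpose-inverse b a)) ⟩
      Djk ⟦ app B u ⟧ e                                  ∎

  ∂-preserves-Cond : ∀ {a b j k : Fin n} → a ≢ b → j ≢ k → ∀ f g → DivRel R a b f g →
    Cond R j k f → Cond R (PC.transpose a b j) (PC.transpose a b k) f → Cond R j k g
  ∂-preserves-Cond {n = n} {a} {b} {j} {k} a≢b j≢k f g ∂fg condτ condsτs =
    specialise≋𝟘⇒Cond j≢k g (cases ((j ≟F a) ×-dec (k ≟F b)) ((j ≟F b) ×-dec (k ≟F a)))
    where
    inj : ∀ (v : Permutation′ n) → Injective _≡_ _≡_ (v ⟨$⟩ʳ_)
    inj = permutation-injective

    module S (v : Permutation′ n) = Specialise (j≢k ∘ inj v)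

    invariant-case : (∀ y → PC.transpose k j y ≡ PC.transpose b a y) →
                     ∀ v → S.specialise v ⟦ difference g j k v ⟧ ≋ 𝟘
    invariant-case τ≗s v e = trans (cong-≋ Δ≋𝟘 e) (homo-𝟘 e)
      where
      open IsAdditive (S.specialise-additive v)
      Δ≋𝟘 : ⟦ difference g j k v ⟧ ≋ 𝟘
      Δ≋𝟘 e = begin
        ⟦ difference g j k v ⟧ e                            ≈⟨ coeff-difference g j k v e ⟩
        ⟦ app g v ⟧ e - ⟦ star R g (transpose j k) v ⟧ e
          ≈⟨ +-cong (∂-invariant a≢b f g ∂fg v e) (-‿cong (resp g (cong (v ⟨$⟩ʳ_) ∘ τ≗s) e)) ⟩
        ⟦ star R g (transpose a b) v ⟧ e - ⟦ star R g (transpose a b) v ⟧ e  ≈⟨ -‿inverseʳ _ ⟩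
        0#                                                  ∎

    cases : Dec (j ≡ a × k ≡ b) → Dec (j ≡ b × k ≡ a) → ∀ v → S.specialise v ⟦ difference g j k v ⟧ ≋ 𝟘
    cases (yes (≡.refl , ≡.refl)) _                        = invariant-case (λ _ → ≡.refl)
    cases (no _)                  (yes (≡.refl , ≡.refl)) = invariant-case (transpose-comm a b)
    cases (no ¬ab)                (no ¬ba)                 v =
      S.specialise-vanishes v (a≢b ∘ inj v)
        (λ (p , q) → ¬ab (≡.sym (inj v p) , ≡.sym (inj v q)))
        (λ (p , q) → ¬ba (≡.sym (inj v p) , ≡.sym (inj v q)))
        ⟦ difference g j k v ⟧ (proj₁ divisible) (proj₂ divisible)
      where divisible = ∂-difference-divisible f g ∂fg condτ condsτs v

corollary4p2 : ∀ {c ℓ p} (R : CommutativeRing c ℓ) (m : ℕ) (i : Fin m)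
    (C : TranspositionSet (suc m) p) →
    mem C (inject₁ i) (Data.Fin.suc i) →
    ∀ (f : H R (suc m)) → HC R C f →
    ∃ (λ (g : H R (suc m)) → DivRel R (inject₁ i) (Data.Fin.suc i) f g)
    × (∀ (g g′ : H R (suc m)) →
         DivRel R (inject₁ i) (Data.Fin.suc i) f g →
         DivRel R (inject₁ i) (Data.Fin.suc i) f g′ →
         ∀ v → _≈P_ R (app g v) (app g′ v))
    × (∀ (g : H R (suc m)) → DivRel R (inject₁ i) (Data.Fin.suc i) f g →
         HPred R (Dset i (mem C)) g)
corollary4p2 R m i C sᵢ∈C f f∈HC =
    f∈HC _ _ sᵢ∈C
  , DivRel-unique R sᵢ≠id f
  , λ g ∂fg j k (τ∈C , sᵢτsᵢ∈C) →
      ∂-preserves-Cond R sᵢ≠id (irrefl C τ∈C) f g ∂fg (f∈HC j k τ∈C) (f∈HC _ _ sᵢτsᵢ∈C)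
  where
  sᵢ≠id = irrefl C sᵢ∈C
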